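{- There is no code $C$ in $D(3,0)=\mathrm{Sh}^3$ with $|C|=4^3$ and code distance $4$.
   Context: The Shrikhande graph $\mathrm{Sh}$ is the Cayley graph on $\mathbb{Z}_4^2$ with connection set $\{01,03,10,30,11,33\}$ (two vertices adjacent iff their difference lies in this set). $D(3,0)$ is the Cartesian product of three copies of $\mathrm{Sh}$; the distance between $(s_1,s_2,s_3)$ and $(s_1',s_2',s_3')$ is $\sum_i d_{\mathrm{Sh}}(s_i,s_i')$. The code distance of a code is the minimum distance between two distinct codewords. -}

module Defs where

open import Data.Nat using (ℕ; zero; suc; _+_; _∸_; _≤_; _%_)
open import Data.Fin using (Fin; toℕ; fromℕ<)
open import Data.Fin.Properties using () renaming (_≟_ to _≟ᶠ_)
open import Data.Nat.DivMod using (m%n<n)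
open import Data.Product using (_×_; _,_; Σ; ∃-syntax)
open import Data.Bool using (Bool; true; false; _∨_; _∧_)
open import Data.List using (List; []; _∷_; allFin; cartesianProduct)
open import Data.Bool.ListAction using (any)
open import Relation.Nullary.Decidable using (⌊_⌋)

Z4 : Set
Z4 = Fin 4

_-₄_ : Z4 → Z4 → Z4
a -₄ b = fromℕ< (m%n<n (toℕ a + (4 ∸ toℕ b)) 4)

-- Shrikhande graph: Cayley graph on ℤ₄² with connection set
-- {01, 03, 10, 30, 11, 33}

V : Set
V = Z4 × Z4

_==_ : V → V → Bool
(a , b) == (c , d) = ⌊ a ≟ᶠ c ⌋ ∧ ⌊ b ≟ᶠ d ⌋

connSet : List V
connSet = (Fin.zero , Fin.suc Fin.zero)
        ∷ (Fin.zero , Fin.suc (Fin.suc (Fin.suc Fin.zero)))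
        ∷ (Fin.suc Fin.zero , Fin.zero)
        ∷ (Fin.suc (Fin.suc (Fin.suc Fin.zero)) , Fin.zero)
        ∷ (Fin.suc Fin.zero , Fin.suc Fin.zero)
        ∷ (Fin.suc (Fin.suc (Fin.suc Fin.zero)) , Fin.suc (Fin.suc (Fin.suc Fin.zero)))
        ∷ []

-- u ~ v iff u - v ∈ connSet  (the set is symmetric)
adj : V → V → Bool
adj (a , b) (c , d) = any (λ s → s == (a -₄ c , b -₄ d)) connSet

allV : List V
allV = cartesianProduct (allFin 4) (allFin 4)

reach : ℕ → V → V → Bool
reach zero    u v = u == v
reach (suc k) u v = reach k u v ∨ any (λ w → reach k u w ∧ adj w v) allV

-- graph distance in Sh: least k with reach k u v (searched up to 16 = |V|;
-- Sh is connected so this bound is never attained spuriously)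
distFrom : ℕ → ℕ → V → V → ℕ
distFrom k zero      u v = k
distFrom k (suc fuel) u v with reach k u v
... | true  = k
... | false = distFrom (suc k) fuel u v

dSh : V → V → ℕ
dSh u v = distFrom 0 16 u v

D30 : Set
D30 = V × V × V

dist : D30 → D30 → ℕ
dist (x₁ , x₂ , x₃) (y₁ , y₂ , y₃) = dSh x₁ y₁ + dSh x₂ y₂ + dSh x₃ y₃

-- In Sh any two vertices are at distance at most 2 and no five vertices are pairwise
-- non-adjacent. So two codewords with the same first coordinate have second coordinates at
-- distance at least 2, each of the 16 fibres of the first projection holds at most 4
-- codewords, and |C| = 64 forces exactly 4 in every fibre. After translating a codeword to
-- 000, a search shows that, up to the automorphisms of Sh fixing 00 applied to the second
-- and third coordinates, the fibre over 00 is one of five configurations, and a second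
-- search shows that none of them extends to four codewords in each of the fibres over the
-- neighbours 01, 11, 10, 30 of 00.

module Submission where

open import Defs
open import Data.Nat using (ℕ; _≤_; _^_)
open import Data.List using (List; length)
open import Data.List.Relation.Unary.Unique.Propositional using (Unique)
open import Data.List.Membership.Propositional using (_∈_)
open import Data.Product using (_×_; ∃-syntax)
open import Relation.Binary.PropositionalEquality using (_≡_)
open import Relation.Nullary using (¬_)

open import Data.Bool using (Bool; true; false; T; not; _∧_; _∨_)
open import Data.Bool.ListAction using (all; any)
open import Data.Bool.Properties using (T-∧; T-∨; T-≡)
open import Data.Empty using (⊥; ⊥-elim)
open import Data.Fin.Patterns using (0F; 1F; 2F; 3F)
open import Data.Fin.Properties using (all?) renaming (_≟_ to _≟ᶠ_)
open import Data.List using ([]; _∷_; map; filter; cartesianProduct)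
open import Data.List.Membership.Propositional using (find)
open import Data.List.Membership.DecPropositional using (_∈?_)
open import Data.List.Membership.Propositional.Properties using (∈-map⁺; ∈-map⁻; ∈-allFin; ∈-cartesianProduct⁺; ∈-filter⁺; ∈-filter⁻)
open import Data.List.Properties using (length-map; length-++; filter-++; map-cong; length-removeAt′)
open import Data.List.Relation.Binary.Subset.Propositional using (_⊆_)
open import Data.List.Relation.Unary.All using (All; []; _∷_)
open import Data.List.Relation.Unary.AllPairs using ([]; _∷_)
open import Data.List.Relation.Unary.All.Properties using (all⁻)
open import Data.List.Relation.Unary.Any using (here; there; index; _─_; satisfied)
open import Data.List.Relation.Unary.Any.Properties using (any⁻)
open import Data.Nat using (suc; _+_; _*_; _<?_; _≤?_; _≟_; z≤n; s≤s)
open import Data.Nat.ListAction using (sum)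
open import Data.Nat.Properties
  using (+-commutativeSemigroup; +-mono-≤; +-monoˡ-≤; +-monoʳ-≤; +-cancelˡ-≤; +-cancelʳ-≤; ≤-trans; ≤-reflexive; <⇒≱; ≮⇒≥; module ≤-Reasoning)
open import Algebra.Properties.CommutativeSemigroup +-commutativeSemigroup using (interchange)
open import Data.Product using (_,_; proj₁; proj₂; map₂)
open import Data.Product.Properties using (≡-dec)
open import Data.Sum using (_⊎_; inj₁; inj₂; [_,_])
open import Function using (_∘_; id; const; Equivalence)
open import Level using (0ℓ)
open import Relation.Binary.Core using (Rel)
open import Relation.Binary.Definitions using (DecidableEquality) renaming (Decidable to Decidable₂)
open import Relation.Binary.PropositionalEquality using (refl; sym; trans; cong; cong₂; subst; _≢_; module ≡-Reasoning)
open import Relation.Nullary using (Dec; yes; no; contradiction; _×-dec_; _⊎-dec_; ¬?)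
open import Relation.Nullary.Decidable using (⌊_⌋; T?; map′; toWitness; fromWitness; from-yes)
open import Relation.Unary using (Pred; Decidable; _∩_)

import Data.List.Relation.Binary.Subset.DecPropositional as DecSubset
import Data.Sum as Sum
import Data.List.Relation.Unary.All as All
import Data.List.Relation.Unary.All.Properties as All
import Data.List.Relation.Unary.Unique.Propositional.Properties as Unique

open Equivalence using (to; from)

private
  variable
    A B : Set
    k : ℕ
    x y : A
    xs ys : List A
    P R : Pred A 0ℓ

AtLeast : ℕ → Pred A 0ℓ → Set
AtLeast k P = ∃[ Y ] Unique Y × k ≤ length Y × All P Y

AtLeast-mono : (∀ {x} → P x → R x) → AtLeast k P → AtLeast k R
AtLeast-mono P⇒R (Y , unique , k≤ , pY) = Y , unique , k≤ , All.map P⇒R pY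

AtLeast-map : (f : A → B) → (∀ {x y} → f x ≡ f y → x ≡ y) → (∀ {x} → P x → R (f x))
            → AtLeast k P → AtLeast k R
AtLeast-map f f-injective P⇒Rf (Y , unique , k≤ , pY) =
  map f Y , Unique.map⁺ f-injective unique ,
  subst (_ ≤_) (sym (length-map f Y)) k≤ , All.map⁺ (All.map P⇒Rf pY)

∈-─ : (p : x ∈ xs) → y ∈ xs → x ≢ y → y ∈ (xs ─ p)
∈-─ (here refl) (here refl) x≢y = ⊥-elim (x≢y refl)
∈-─ (here _)    (there q)   _   = q
∈-─ (there _)   (here refl) _   = here refl
∈-─ (there p)   (there q)   x≢y = there (∈-─ p q x≢y)

unique-⊆⇒length-≤ : Unique ys → ys ⊆ xs → length ys ≤ length xs
unique-⊆⇒length-≤ {ys = []}     _              _     = z≤n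
unique-⊆⇒length-≤ {ys = y ∷ ys} {xs} (y∉ys ∷ unique) ys⊆xs = begin
  suc (length ys)          ≤⟨ s≤s (unique-⊆⇒length-≤ unique ys⊆xs─y) ⟩
  suc (length (xs ─ y∈xs)) ≡⟨ sym (length-removeAt′ xs (index y∈xs)) ⟩
  length xs                ∎
  where
  open ≤-Reasoning
  y∈xs : y ∈ xs
  y∈xs = ys⊆xs (here refl)
  ys⊆xs─y : ys ⊆ (xs ─ y∈xs)
  ys⊆xs─y z∈ys = ∈-─ y∈xs (ys⊆xs (there z∈ys)) (All.lookup y∉ys z∈ys)

AtLeast-∈⇒≤length : AtLeast k (_∈ xs) → k ≤ length xs
AtLeast-∈⇒≤length (Y , unique , k≤ , Y⊆xs) = ≤-trans k≤ (unique-⊆⇒length-≤ unique (All.lookup Y⊆xs))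

unique-map⁺-∈ : (f : A → B) → (∀ {x y} → x ∈ xs → y ∈ xs → f x ≡ f y → x ≡ y)
              → Unique xs → Unique (map f xs)
unique-map⁺-∈ {xs = []}     f _           []              = []
unique-map⁺-∈ {xs = x ∷ xs} f f-injective (x∉xs ∷ unique) =
  All.map⁺ (All.tabulate λ y∈xs fx≡fy → All.lookup x∉xs y∈xs (f-injective (here refl) (there y∈xs) fx≡fy))
  ∷ unique-map⁺-∈ f (λ p q → f-injective (there p) (there q)) unique

sum-map-+ : (f g : A → ℕ) (xs : List A) → sum (map (λ x → f x + g x) xs) ≡ sum (map f xs) + sum (map g xs)
sum-map-+ f g []       = refl
sum-map-+ f g (x ∷ xs) = trans (cong (f x + g x +_) (sum-map-+ f g xs))
                               (interchange (f x) (g x) (sum (map f xs)) (sum (map g xs)))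

sum-map-≤ : ∀ {b} (f : A → ℕ) → (∀ x → f x ≤ b) → ∀ xs → sum (map f xs) ≤ length xs * b
sum-map-≤ f f≤b []       = z≤n
sum-map-≤ f f≤b (x ∷ xs) = +-mono-≤ (f≤b x) (sum-map-≤ f f≤b xs)

sum-map-saturated : ∀ {b} (f : A → ℕ) → (∀ x → f x ≤ b) → ∀ xs → length xs * b ≤ sum (map f xs) → x ∈ xs → b ≤ f x
sum-map-saturated {b = b} f f≤b (x ∷ xs) full (here refl) =
  +-cancelʳ-≤ (length xs * b) b (f x) (≤-trans full (+-monoʳ-≤ (f x) (sum-map-≤ f f≤b xs)))
sum-map-saturated {b = b} f f≤b (y ∷ xs) full (there x∈xs) =
  sum-map-saturated f f≤b xs (+-cancelˡ-≤ b _ _ (≤-trans full (+-monoˡ-≤ (sum (map f xs)) (f≤b y)))) x∈xs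

module Search {A : Set} (_≟ᴬ_ : DecidableEquality A) {_~_ : Rel A 0ℓ} (_~?_ : Decidable₂ _~_)
              (k : ℕ) (finish : List A → Bool) where

  compatible : List A → A → Bool
  compatible known y = all (λ x → ⌊ y ~? x ⌋) known

  -- Backtracking: refutes known Ps holds when every way of adding to known at least k elements
  -- of each part in Ps, all chosen elements being pairwise _~_-related, is rejected by finish.
  -- A candidate is taken or skipped, and it cannot be skipped once known.
  mutual
    refutes : List A → List (List A) → Bool
    refutes known []       = finish known
    refutes known (P ∷ Ps) = refutesFrom known 0 (filter (T? ∘ compatible known) P) Ps

    refutesFrom : List A → ℕ → List A → List (List A) → Bool
    refutesFrom known n []       Ps = ⌊ n <? k ⌋ ∨ refutes known Ps
    refutesFrom known n (y ∷ ys) Ps =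
      (not (compatible known y) ∨ refutesFrom (y ∷ known) (suc n) ys Ps)
      ∧ (⌊ _∈?_ _≟ᴬ_ y known ⌋ ∨ refutesFrom known n ys Ps)

module SearchSound {A : Set} (_≟ᴬ_ : DecidableEquality A) {_~_ : Rel A 0ℓ} (_~?_ : Decidable₂ _~_)
                   (k : ℕ) (finish : List A → Bool)
                   {Q : Pred A 0ℓ} (Q? : Decidable Q) (Q-related : ∀ {x y} → Q x → Q y → x ~ y)
                   (finish-sound : ∀ {known} → T (finish known) → All Q known → ⊥) where

  open Search _≟ᴬ_ _~?_ k finish

  compatible-sound : ∀ {known y} → All Q known → Q y → T (compatible known y)
  compatible-sound qKnown qy = all⁻ _ (All.map (λ qx → fromWitness (Q-related qy qx)) qKnown)

  Remaining : List A → List A → Pred A 0ℓ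
  Remaining taken ys z = z ∈ taken ⊎ z ∈ ys

  take : ∀ {y ys taken z} → Remaining taken (y ∷ ys) z → Remaining (y ∷ taken) ys z
  take (inj₁ z∈taken)      = inj₁ (there z∈taken)
  take (inj₂ (here z≡y))   = inj₁ (here z≡y)
  take (inj₂ (there z∈ys)) = inj₂ z∈ys

  skip : ∀ {y ys taken z} → ¬ Q y → Q z → Remaining taken (y ∷ ys) z → Remaining taken ys z
  skip _   _  (inj₁ z∈taken)      = inj₁ z∈taken
  skip ¬qy qz (inj₂ (here refl))  = ⊥-elim (¬qy qz)
  skip _   _  (inj₂ (there z∈ys)) = inj₂ z∈ys

  taken-branch : ∀ a {b c} → T a → T ((not a ∨ b) ∧ c) → T b
  taken-branch true {b} _ t = proj₁ (to (T-∧ {b}) t)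

  skipped-branch : ∀ a {b m c} → T ((not a ∨ b) ∧ (m ∨ c)) → T m ⊎ T c
  skipped-branch a {b} {m} t = to (T-∨ {m}) (proj₂ (to (T-∧ {not a ∨ b}) t))

  mutual
    refutes-sound : ∀ known Ps → T (refutes known Ps) → All Q known
                  → All (λ P → AtLeast k (Q ∩ (_∈ P))) Ps → ⊥
    refutes-sound known []       r qKnown []             = finish-sound r qKnown
    refutes-sound known (P ∷ Ps) r qKnown (hit ∷ hits) =
      refutesFrom-sound _ Ps [] r qKnown refl (AtLeast-mono start hit) hits
      where
      start : ∀ {y} → (Q ∩ (_∈ P)) y → (Q ∩ Remaining [] (filter (T? ∘ compatible known) P)) y
      start (qy , y∈P) = qy , inj₂ (∈-filter⁺ (T? ∘ compatible known) y∈P (compatible-sound qKnown qy))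

    -- Invariant: the k witnesses for the current part lie in taken or among the remaining
    -- candidates ys, so running out of candidates with fewer than k taken is impossible.
    refutesFrom-sound : ∀ {known n} ys Ps taken → T (refutesFrom known n ys Ps) → All Q known
                      → length taken ≡ n → AtLeast k (Q ∩ Remaining taken ys)
                      → All (λ P → AtLeast k (Q ∩ (_∈ P))) Ps → ⊥
    refutesFrom-sound {known} {n} [] Ps taken r qKnown |taken| hit hits =
      [ (λ n<k → <⇒≱ (toWitness n<k) (subst (k ≤_) |taken| (AtLeast-∈⇒≤length (AtLeast-mono taken-only hit))))
      , (λ r′ → refutes-sound known Ps r′ qKnown hits)
      ] (to (T-∨ {⌊ n <? k ⌋}) r)
      where
      taken-only : ∀ {z} → (Q ∩ Remaining taken []) z → z ∈ taken
      taken-only (_ , inj₁ z∈taken) = z∈taken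
    refutesFrom-sound {known} (y ∷ ys) Ps taken r qKnown |taken| hit hits with Q? y
    ... | yes qy =
      refutesFrom-sound ys Ps (y ∷ taken) (taken-branch (compatible known y) (compatible-sound qKnown qy) r)
        (qy ∷ qKnown) (cong suc |taken|) (AtLeast-mono (map₂ take) hit) hits
    ... | no ¬qy =
      [ (λ y∈known → ¬qy (All.lookup qKnown (toWitness y∈known)))
      , (λ r′ → refutesFrom-sound ys Ps taken r′ qKnown |taken| (AtLeast-mono skip′ hit) hits)
      ] (skipped-branch (compatible known y) r)
      where
      skip′ : ∀ {z} → (Q ∩ Remaining taken (y ∷ ys)) z → (Q ∩ Remaining taken ys) z
      skip′ (qz , z∈) = qz , skip ¬qy qz z∈

origin : V
origin = (0F , 0F)

infixl 6 _+₄_ _⊕_ _⊖_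
infixl 7 _·₄_
infix  4 _≟ⱽ_

_+₄_ : Z4 → Z4 → Z4
a +₄ b = a -₄ (0F -₄ b)

_·₄_ : Z4 → Z4 → Z4
0F ·₄ b = 0F
1F ·₄ b = b
2F ·₄ b = b +₄ b
3F ·₄ b = 0F -₄ b

_⊕_ : V → V → V
(a , b) ⊕ (c , d) = (a +₄ c , b +₄ d)

_⊖_ : V → V → V
(a , b) ⊖ (c , d) = (a -₄ c , b -₄ d)

-- Sh has diameter 2: the connection set is at distance 1 from 00, everything else at distance 2.
shNorm : V → ℕ
shNorm (0F , 0F) = 0
shNorm (0F , 1F) = 1
shNorm (0F , 3F) = 1
shNorm (1F , 0F) = 1
shNorm (3F , 0F) = 1
shNorm (1F , 1F) = 1
shNorm (3F , 3F) = 1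
shNorm _         = 2

shDist : V → V → ℕ
shDist u v = shNorm (u ⊖ v)

_≟ⱽ_ : DecidableEquality V
_≟ⱽ_ = ≡-dec _≟ᶠ_ _≟ᶠ_

∈-allV : ∀ u → u ∈ allV
∈-allV (a , b) = ∈-cartesianProduct⁺ (∈-allFin a) (∈-allFin b)

∀V? : {P : Pred V 0ℓ} → Decidable P → Dec (∀ u → P u)
∀V? P? = map′ (λ h (a , b) → h a b) (λ h a b → h (a , b)) (all? λ a → all? λ b → P? (a , b))

dSh≡shDist : ∀ u v → dSh u v ≡ shDist u v
dSh≡shDist = from-yes (∀V? λ u → ∀V? λ v → dSh u v ≟ shDist u v)

shDist≤2 : ∀ u v → shDist u v ≤ 2
shDist≤2 = from-yes (∀V? λ u → ∀V? λ v → shDist u v ≤? 2)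

shDist-refl : ∀ u → shDist u u ≡ 0
shDist-refl = from-yes (∀V? λ u → shDist u u ≟ 0)

⊕-identityˡ : ∀ u → origin ⊕ u ≡ u
⊕-identityˡ = from-yes (∀V? λ u → origin ⊕ u ≟ⱽ u)

NonAdjacent : Rel V 0ℓ
NonAdjacent u v = shDist u v ≢ 1

shDist≥2⇒≢ : ∀ {u v} → 2 ≤ shDist u v → u ≢ v
shDist≥2⇒≢ {u} 2≤d refl = contradiction (subst (2 ≤_) (shDist-refl u) 2≤d) λ ()

≡⊎shDist≥2⇒NonAdjacent : ∀ {u v} → u ≡ v ⊎ 2 ≤ shDist u v → NonAdjacent u v
≡⊎shDist≥2⇒NonAdjacent {u} (inj₁ refl) d≡1 = contradiction (trans (sym (shDist-refl u)) d≡1) λ ()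
≡⊎shDist≥2⇒NonAdjacent     (inj₂ 2≤d)  d≡1 = contradiction (subst (2 ≤_) d≡1 2≤d) λ { (s≤s ()) }

nonAdjacent? : Decidable₂ NonAdjacent
nonAdjacent? u v = ¬? (shDist u v ≟ 1)

independent-length≤4 : (I : List V) → Unique I → (∀ {u v} → u ∈ I → v ∈ I → NonAdjacent u v) → length I ≤ 4
independent-length≤4 I unique independent = ≮⇒≥ λ 4<|I| →
  refutes-sound [] (allV ∷ []) _ [] ((I , unique , 4<|I| , All.tabulate (λ u∈I → u∈I , ∈-allV _)) ∷ [])
  where
  open SearchSound _≟ⱽ_ nonAdjacent? 5 (const false) (λ u → _∈?_ _≟ⱽ_ u I) independent (λ ())

record IsIsometry (f g : V → V) : Set where
  field
    inverseˡ  : ∀ u → f (g u) ≡ u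
    inverseʳ  : ∀ u → g (f u) ≡ u
    isometric : ∀ u v → shDist (f u) (f v) ≡ shDist u v

isIsometry? : ∀ f g → Dec (IsIsometry f g)
isIsometry? f g = map′ (λ (l , r , i) → record { inverseˡ = l ; inverseʳ = r ; isometric = i })
                       (λ i → IsIsometry.inverseˡ i , IsIsometry.inverseʳ i , IsIsometry.isometric i)
                       ((∀V? λ u → f (g u) ≟ⱽ u) ×-dec (∀V? λ u → g (f u) ≟ⱽ u)
                         ×-dec (∀V? λ u → ∀V? λ v → shDist (f u) (f v) ≟ shDist u v))

record Isometry : Set where
  field
    to from    : V → V
    isIsometry : IsIsometry to from
  open IsIsometry isIsometry public

isometry : (f g : V → V) → {T ⌊ isIsometry? f g ⌋} → Isometry
isometry f g {checked} = record { to = f ; from = g ; isIsometry = toWitness checked }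

identity : Isometry
identity = record
  { to = id ; from = id
  ; isIsometry = record { inverseˡ = λ _ → refl ; inverseʳ = λ _ → refl ; isometric = λ _ _ → refl }
  }

translation : V → Isometry
translation c = record
  { to = _⊕ c ; from = _⊖ c
  ; isIsometry = from-yes (∀V? λ c → isIsometry? (_⊕ c) (_⊖ c)) c
  }

linear : Z4 → Z4 → Z4 → Z4 → V → V
linear a b c d (x , y) = (a ·₄ x +₄ b ·₄ y , c ·₄ x +₄ d ·₄ y)

stabiliser : List Isometry
stabiliser =
    isometry (linear 0F 1F 1F 0F) (linear 0F 1F 1F 0F)
  ∷ isometry (linear 0F 1F 3F 1F) (linear 1F 3F 1F 0F)
  ∷ isometry (linear 0F 3F 1F 3F) (linear 3F 1F 3F 0F)
  ∷ isometry (linear 0F 3F 3F 0F) (linear 0F 3F 3F 0F)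
  ∷ isometry (linear 1F 0F 0F 1F) (linear 1F 0F 0F 1F)
  ∷ isometry (linear 1F 0F 1F 3F) (linear 1F 0F 1F 3F)
  ∷ isometry (linear 1F 3F 0F 3F) (linear 1F 3F 0F 3F)
  ∷ isometry (linear 1F 3F 1F 0F) (linear 0F 1F 3F 1F)
  ∷ isometry (linear 3F 0F 0F 3F) (linear 3F 0F 0F 3F)
  ∷ isometry (linear 3F 0F 3F 1F) (linear 3F 0F 3F 1F)
  ∷ isometry (linear 3F 1F 0F 1F) (linear 3F 1F 0F 1F)
  ∷ isometry (linear 3F 1F 3F 0F) (linear 0F 3F 1F 3F)
  ∷ []

infix 4 _≟ᴰ_

_≟ᴰ_ : DecidableEquality D30
_≟ᴰ_ = ≡-dec _≟ⱽ_ (≡-dec _≟ⱽ_ _≟ⱽ_)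

origin₃ : D30
origin₃ = (origin , origin , origin)

second : D30 → V
second = proj₁ ∘ proj₂

dist′ : D30 → D30 → ℕ
dist′ (x₁ , x₂ , x₃) (y₁ , y₂ , y₃) = shDist x₁ y₁ + shDist x₂ y₂ + shDist x₃ y₃

dist≡dist′ : ∀ x y → dist x y ≡ dist′ x y
dist≡dist′ (x₁ , x₂ , x₃) (y₁ , y₂ , y₃) =
  cong₂ _+_ (cong₂ _+_ (dSh≡shDist x₁ y₁) (dSh≡shDist x₂ y₂)) (dSh≡shDist x₃ y₃)

Distance≥4 : List D30 → Set
Distance≥4 C = ∀ x y → x ∈ C → y ∈ C → ¬ x ≡ y → 4 ≤ dist x y

Separated : Rel D30 0ℓ
Separated x y = x ≡ y ⊎ 4 ≤ dist′ x y

separated? : Decidable₂ Separated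
separated? x y = (x ≟ᴰ y) ⊎-dec (4 ≤? dist′ x y)

fibre : List D30 → V → List D30
fibre C t = filter (λ x → proj₁ x ≟ⱽ t) C

wordsOver : V → List D30
wordsOver t = map (t ,_) (cartesianProduct allV allV)

∈-wordsOver : ∀ {t} x → proj₁ x ≡ t → x ∈ wordsOver t
∈-wordsOver (t , u , v) refl = ∈-map⁺ (t ,_) (∈-cartesianProduct⁺ (∈-allV u) (∈-allV v))

record FullCode (Q : Pred D30 0ℓ) : Set where
  field
    decide    : Decidable Q
    separated : ∀ {x y} → Q x → Q y → Separated x y
    full      : ∀ t → AtLeast 4 (Q ∩ (λ x → proj₁ x ≡ t))

  fibre-hits : ∀ t → AtLeast 4 (Q ∩ (_∈ wordsOver t))
  fibre-hits t = AtLeast-mono (λ (qx , x₁≡t) → qx , ∈-wordsOver _ x₁≡t) (full t)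

second-apart : ∀ {C t x y} → Distance≥4 C → x ∈ fibre C t → y ∈ fibre C t → x ≢ y → 2 ≤ shDist (second x) (second y)
second-apart {C} {t} {x@(_ , x₂ , x₃)} {y@(_ , y₂ , y₃)} distance≥4 x∈ y∈ x≢y
  with ∈-filter⁻ (λ x → proj₁ x ≟ⱽ t) x∈ | ∈-filter⁻ (λ x → proj₁ x ≟ⱽ t) y∈
... | x∈C , refl | y∈C , refl = +-cancelʳ-≤ 2 2 _ (begin
  4                                        ≤⟨ distance≥4 x y x∈C y∈C x≢y ⟩
  dist x y                                 ≡⟨ dist≡dist′ x y ⟩
  shDist t t + shDist x₂ y₂ + shDist x₃ y₃ ≡⟨ cong (λ d → d + shDist x₂ y₂ + shDist x₃ y₃) (shDist-refl t) ⟩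
  shDist x₂ y₂ + shDist x₃ y₃              ≤⟨ +-monoʳ-≤ (shDist x₂ y₂) (shDist≤2 x₃ y₃) ⟩
  shDist x₂ y₂ + 2                         ∎)
  where open ≤-Reasoning

fibre-length≤4 : ∀ {C} → Unique C → Distance≥4 C → ∀ t → length (fibre C t) ≤ 4
fibre-length≤4 {C} unique distance≥4 t = begin
  length (fibre C t)              ≡⟨ sym (length-map second (fibre C t)) ⟩
  length (map second (fibre C t)) ≤⟨ independent-length≤4 _ (unique-map⁺-∈ second injective unique-fibre) nonAdjacent ⟩
  4                               ∎
  where
  open ≤-Reasoning
  unique-fibre : Unique (fibre C t)
  unique-fibre = Unique.filter⁺ (λ x → proj₁ x ≟ⱽ t) unique
  second-separated : ∀ {x y} → x ∈ fibre C t → y ∈ fibre C t → x ≡ y ⊎ 2 ≤ shDist (second x) (second y)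
  second-separated {x} {y} x∈ y∈ with x ≟ᴰ y
  ... | yes x≡y = inj₁ x≡y
  ... | no  x≢y = inj₂ (second-apart distance≥4 x∈ y∈ x≢y)
  injective : ∀ {x y} → x ∈ fibre C t → y ∈ fibre C t → second x ≡ second y → x ≡ y
  injective x∈ y∈ x₂≡y₂ = [ id , (λ 2≤d → contradiction x₂≡y₂ (shDist≥2⇒≢ 2≤d)) ] (second-separated x∈ y∈)
  nonAdjacent : ∀ {u v} → u ∈ map second (fibre C t) → v ∈ map second (fibre C t) → NonAdjacent u v
  nonAdjacent u∈ v∈ with ∈-map⁻ second u∈ | ∈-map⁻ second v∈
  ... | x , x∈ , refl | y , y∈ , refl = ≡⊎shDist≥2⇒NonAdjacent (Sum.map₁ (cong second) (second-separated x∈ y∈))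

fibreSize : List D30 → V → ℕ
fibreSize C t = length (fibre C t)

fibreSize-∷ : ∀ x C t → fibreSize (x ∷ C) t ≡ fibreSize (x ∷ []) t + fibreSize C t
fibreSize-∷ x C t = trans (cong length (filter-++ (λ x → proj₁ x ≟ⱽ t) (x ∷ []) C)) (length-++ (fibre (x ∷ []) t))

sum-fibreSize-[_] : ∀ x → sum (map (fibreSize (x ∷ [])) allV) ≡ 1
sum-fibreSize-[ u , w ] = from-yes (∀V? λ u → sum (map (fibreSize ((u , w) ∷ [])) allV) ≟ 1) u

sum-fibreSize : ∀ C → sum (map (fibreSize C) allV) ≡ length C
sum-fibreSize []      = refl
sum-fibreSize (x ∷ C) = begin
  sum (map (fibreSize (x ∷ C)) allV)                                  ≡⟨ cong sum (map-cong (fibreSize-∷ x C) allV) ⟩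
  sum (map (λ t → fibreSize (x ∷ []) t + fibreSize C t) allV)         ≡⟨ sum-map-+ (fibreSize (x ∷ [])) (fibreSize C) allV ⟩
  sum (map (fibreSize (x ∷ [])) allV) + sum (map (fibreSize C) allV)  ≡⟨ cong₂ _+_ sum-fibreSize-[ x ] (sum-fibreSize C) ⟩
  1 + length C                                                        ∎
  where open ≡-Reasoning

full-code : ∀ {C} → Unique C → Distance≥4 C → length C ≡ 4 ^ 3 → FullCode (_∈ C)
full-code {C} unique distance≥4 |C|≡64 = record
  { decide    = λ x → _∈?_ _≟ᴰ_ x C
  ; separated = separated
  ; full      = λ t → fibre C t , Unique.filter⁺ (λ x → proj₁ x ≟ⱽ t) unique , fibre-length≥4 t
                    , All.tabulate (∈-filter⁻ (λ x → proj₁ x ≟ⱽ t))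
  }
  where
  separated : ∀ {x y} → x ∈ C → y ∈ C → Separated x y
  separated {x} {y} x∈C y∈C with x ≟ᴰ y
  ... | yes x≡y = inj₁ x≡y
  ... | no  x≢y = inj₂ (subst (4 ≤_) (dist≡dist′ x y) (distance≥4 x y x∈C y∈C x≢y))
  fibre-length≥4 : ∀ t → 4 ≤ length (fibre C t)
  fibre-length≥4 t = sum-map-saturated (fibreSize C) (fibre-length≤4 unique distance≥4) allV
                       (≤-reflexive (trans (sym |C|≡64) (sym (sum-fibreSize C)))) (∈-allV t)

on₃ : (V → V) → (V → V) → (V → V) → D30 → D30
on₃ f g h (x₁ , x₂ , x₃) = (f x₁ , g x₂ , h x₃)

module ProductIsometry (σ₁ σ₂ σ₃ : Isometry) where
  open Isometry

  ρ ρ⁻¹ : D30 → D30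
  ρ   = on₃ (to σ₁) (to σ₂) (to σ₃)
  ρ⁻¹ = on₃ (from σ₁) (from σ₂) (from σ₃)

  ρ∘ρ⁻¹ : ∀ x → ρ (ρ⁻¹ x) ≡ x
  ρ∘ρ⁻¹ (x₁ , x₂ , x₃) = cong₂ _,_ (inverseˡ σ₁ x₁) (cong₂ _,_ (inverseˡ σ₂ x₂) (inverseˡ σ₃ x₃))

  ρ⁻¹∘ρ : ∀ x → ρ⁻¹ (ρ x) ≡ x
  ρ⁻¹∘ρ (x₁ , x₂ , x₃) = cong₂ _,_ (inverseʳ σ₁ x₁) (cong₂ _,_ (inverseʳ σ₂ x₂) (inverseʳ σ₃ x₃))

  ρ-injective : ∀ {x y} → ρ x ≡ ρ y → x ≡ y
  ρ-injective {x} {y} ρx≡ρy = trans (sym (ρ⁻¹∘ρ x)) (trans (cong ρ⁻¹ ρx≡ρy) (ρ⁻¹∘ρ y))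

  ρ⁻¹-injective : ∀ {x y} → ρ⁻¹ x ≡ ρ⁻¹ y → x ≡ y
  ρ⁻¹-injective {x} {y} e = trans (sym (ρ∘ρ⁻¹ x)) (trans (cong ρ e) (ρ∘ρ⁻¹ y))

  dist′-ρ : ∀ x y → dist′ (ρ x) (ρ y) ≡ dist′ x y
  dist′-ρ (x₁ , x₂ , x₃) (y₁ , y₂ , y₃) =
    cong₂ _+_ (cong₂ _+_ (isometric σ₁ x₁ y₁) (isometric σ₂ x₂ y₂)) (isometric σ₃ x₃ y₃)

  transport : ∀ {Q} → FullCode Q → FullCode (Q ∘ ρ)
  transport {Q} G = record
    { decide    = decide ∘ ρ
    ; separated = λ qx qy → Sum.map ρ-injective (subst (4 ≤_) (dist′-ρ _ _)) (separated qx qy)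
    ; full      = λ t → AtLeast-map ρ⁻¹ ρ⁻¹-injective (pull-back t) (full (to σ₁ t))
    }
    where
    open FullCode G
    pull-back : ∀ t {x} → (Q ∩ (λ x → proj₁ x ≡ to σ₁ t)) x → ((Q ∘ ρ) ∩ (λ x → proj₁ x ≡ t)) (ρ⁻¹ x)
    pull-back t {x} (qx , refl) = subst Q (sym (ρ∘ρ⁻¹ x)) qx , inverseʳ σ₁ t

refutesCode : (List D30 → Bool) → List D30 → List (List D30) → Bool
refutesCode = Search.refutes _≟ᴰ_ separated? 4

refutesCode-sound : ∀ {Q} → FullCode Q → (finish : List D30 → Bool) → (∀ {F} → T (finish F) → All Q F → ⊥)
                  → ∀ known Ps → refutesCode finish known Ps ≡ true → All Q known
                  → All (λ P → AtLeast 4 (Q ∩ (_∈ P))) Ps → ⊥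
refutesCode-sound G finish finish-sound known Ps refuted =
  SearchSound.refutes-sound _≟ᴰ_ separated? 4 finish (FullCode.decide G) (FullCode.separated G) finish-sound
    known Ps (from T-≡ refuted)

neighbours : List V
neighbours = (0F , 1F) ∷ (1F , 1F) ∷ (1F , 0F) ∷ (3F , 0F) ∷ []

-- Up to stabiliser acting on the second and third coordinates, every four pairwise separated
-- words over 00 including 000 form one of these lists; origin-fibre-refuted checks this.
representatives : List (List D30)
representatives =
    (w 0F 0F 0F 0F ∷ w 0F 2F 0F 2F ∷ w 2F 0F 2F 0F ∷ w 2F 2F 2F 2F ∷ [])
  ∷ (w 0F 0F 0F 0F ∷ w 0F 2F 0F 2F ∷ w 2F 0F 2F 1F ∷ w 2F 2F 2F 3F ∷ [])
  ∷ (w 0F 0F 0F 0F ∷ w 0F 2F 0F 2F ∷ w 2F 1F 2F 0F ∷ w 2F 3F 2F 2F ∷ [])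
  ∷ (w 0F 0F 0F 0F ∷ w 0F 2F 0F 2F ∷ w 2F 1F 2F 1F ∷ w 2F 3F 2F 3F ∷ [])
  ∷ (w 0F 0F 0F 0F ∷ w 0F 2F 1F 2F ∷ w 2F 1F 2F 0F ∷ w 2F 3F 3F 2F ∷ [])
  ∷ []
  where
  w : Z4 → Z4 → Z4 → Z4 → D30
  w a b c d = (origin , (a , b) , (c , d))

refutedFrom : List D30 → Bool
refutedFrom R = refutesCode (const false) R (map wordsOver neighbours)

representatives-refuted : All (λ R → refutedFrom R ≡ true) representatives
representatives-refuted = refl ∷ refl ∷ refl ∷ refl ∷ refl ∷ []

representative-impossible : ∀ {Q R} → FullCode Q → R ∈ representatives → All Q R → ⊥
representative-impossible G R∈ qR =
  refutesCode-sound G (const false) (λ ()) _ (map wordsOver neighbours)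
    (All.lookup representatives-refuted R∈) qR
    (All.map⁺ (All.universal (FullCode.fibre-hits G) neighbours))

reducesVia : List D30 → Isometry → Isometry → List D30 → Bool
reducesVia F σ τ R = ⌊ DecSubset._⊆?_ _≟ᴰ_ R (map (on₃ id (Isometry.from σ) (Isometry.from τ)) F) ⌋

reducibleBy : List D30 → Isometry → Isometry → Bool
reducibleBy F σ τ = any (reducesVia F σ τ) representatives

reducible : List D30 → Bool
reducible F = any (λ σ → any (reducibleBy F σ) stabiliser) stabiliser

reducesVia-impossible : ∀ {Q F} → FullCode Q → All Q F → ∀ σ τ {R} → R ∈ representatives → T (reducesVia F σ τ R) → ⊥
reducesVia-impossible {Q} {F} G qF σ τ {R} R∈ rR = representative-impossible (transport G) R∈ (All.tabulate qR)
  where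
  open ProductIsometry identity σ τ
  R⊆ρ⁻¹F : R ⊆ map ρ⁻¹ F
  R⊆ρ⁻¹F = toWitness rR
  qR : ∀ {r} → r ∈ R → Q (ρ r)
  qR r∈R with ∈-map⁻ ρ⁻¹ (R⊆ρ⁻¹F r∈R)
  ... | x , x∈F , refl = subst Q (sym (ρ∘ρ⁻¹ x)) (All.lookup qF x∈F)

reducible-impossible : ∀ {Q F} → FullCode Q → T (reducible F) → All Q F → ⊥
reducible-impossible {F = F} G r qF =
  let σ , rσ      = satisfied (any⁻ (λ σ → any (reducibleBy F σ) stabiliser) stabiliser r)
      τ , rτ      = satisfied (any⁻ (reducibleBy F σ) stabiliser rσ)
      R , R∈ , rR = find (any⁻ (reducesVia F σ τ) representatives rτ)
  in reducesVia-impossible G qF σ τ R∈ rR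

origin-fibre-refuted : refutesCode reducible (origin₃ ∷ []) (wordsOver origin ∷ []) ≡ true
origin-fibre-refuted = refl

no-full-code-through-origin : ∀ {Q} → FullCode Q → Q origin₃ → ⊥
no-full-code-through-origin G q₀ =
  refutesCode-sound G reducible (reducible-impossible G) (origin₃ ∷ []) (wordsOver origin ∷ [])
    origin-fibre-refuted (q₀ ∷ []) (FullCode.fibre-hits G origin ∷ [])

proposition5 : ¬ (∃[ C ] (Unique C × length C ≡ 4 ^ 3
    × (∀ x y → x ∈ C → y ∈ C → ¬ x ≡ y → 4 ≤ dist x y)
    × ∃[ x ] ∃[ y ] (x ∈ C × y ∈ C × ¬ x ≡ y × dist x y ≡ 4)))
-- Minimum distance at least 4 already suffices: of the last hypothesis only a codeword is used.
proposition5 (C , unique , |C|≡64 , distance≥4 , (x₁ , x₂ , x₃) , _ , x∈C , _) =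
  no-full-code-through-origin (transport (full-code unique distance≥4 |C|≡64)) ρ₀∈C
  where
  open ProductIsometry (translation x₁) (translation x₂) (translation x₃)
  ρ₀∈C : ρ origin₃ ∈ C
  ρ₀∈C = subst (_∈ C) (sym (cong₂ _,_ (⊕-identityˡ x₁) (cong₂ _,_ (⊕-identityˡ x₂) (⊕-identityˡ x₃)))) x∈C
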